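{- Let $\alpha>0$ be a fixed small constant. For every positive integer $q$, $$\sum_{\substack{1\leq r\leq q-1\\ \gcd(r,q)>q^{\frac 15-\alpha}}}\frac 1r\ll q^{ -\frac 15+3\alpha}.$$
   Formalization: The fixed constant α ranges over the positive rationals. -}

module Defs where

open import Data.Nat using (ℕ; zero; suc; _*_; _^_; _<?_)
open import Data.Nat.GCD using (gcd)
open import Data.Integer using (+_)
open import Data.List using (List; []; _∷_; foldr; map; filter; drop; upTo)
open import Data.Rational using (ℚ; 0ℚ; 1ℚ; _/_) renaming (_+_ to _+ℚ_; _*_ to _*ℚ_)

_^ℚ_ : ℚ → ℕ → ℚ
x ^ℚ zero  = 1ℚ
x ^ℚ suc n = x *ℚ (x ^ℚ n)

-- 1 / r  (only used for r ≥ 1)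
recip : ℕ → ℚ
recip zero    = 0ℚ
recip (suc k) = + 1 / suc k

sumℚ : List ℚ → ℚ
sumℚ = foldr _+ℚ_ 0ℚ

range1 : ℕ → List ℕ
range1 q = drop 1 (upTo q)

-- With α = a/b (a, b ≥ 1), the condition  gcd(r,q) > q^(1/5 - α)
-- is equivalent (all quantities positive) to
--   gcd(r,q)^(5b) > q^(b - 5a),  i.e.  q^b < gcd(r,q)^(5b) * q^(5a).
S : ℕ → ℕ → ℕ → ℚ
S a b q = sumℚ (map recip
  (filter (λ r → q ^ b <? (gcd r q ^ (5 * b)) * (q ^ (5 * a))) (range1 q)))

{-# OPTIONS --safe #-}
-- Write α = A/B, so that gcd(r, N) > N^(1/5 - α) reads N^B < g^(5B) N^(5A) for g = gcd(r, N), and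
-- let g₀ be the least g with this property. Each counted r is g j with g a divisor of N, g ≥ g₀ and
-- j ≤ N, and the pair (g, j) determines r; hence the sum is at most τ(N) H(N+1) / g₀, where τ counts
-- divisors and H(N+1) = 1 + 1/2 + … + 1/N ≤ 1 + log₂ N. Both τ(N) and log N are O(N^α): on the one
-- hand (k+1)^B ≤ B^B 2^k; on the other τ is submultiplicative with τ(p^k)^B ≤ p^(kA) once p ≥ 2^B,
-- while each of the finitely many smaller primes contributes a factor at most B^B. Raising everything
-- to the power 5B clears the fractional exponents: S^(5B) N^B ≤ (τ(N) H(N+1))^(5B) N^(5A) ≤ C^(5B) N^(15A).
module Submission where

open import Defs using (_^ℚ_; recip; sumℚ; S)
open import Data.Nat.Base using (ℕ)
open import Data.Product.Base using (∃; ∃₂; ∃-syntax; _×_; _,_)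
open import Data.Sum.Base using (_⊎_; inj₁; inj₂)
open import Function.Base using (_∘_)
open import Relation.Nullary.Decidable using (Dec; does; yes; no; _×-dec_)
open import Relation.Nullary.Negation using (¬_; contradiction)
open import Relation.Unary using (Pred; Decidable)
open import Relation.Binary.PropositionalEquality

module Arithmetic where

  open import Data.Nat
  open import Data.Nat.Properties
  open import Data.Nat.Divisibility
    using (_∣_; _∤_; _∣?_; divides; ∣-refl; *-cancelˡ-∣; ∣1⇒≡1; quotient; quotient-<; quotient≢0;
           m∣n⇒n≡m*quotient)
  open import Data.Nat.DivMod using (m*[n/m]≡n)
  open import Data.Nat.GCD using (gcd; gcd[m,n]∣m; gcd[m,n]∣n; gcd[m,n]≢0)
  open import Data.Nat.Coprimality using (coprime-divisor; coprime-/gcd; gcd≡1⇒coprime)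
  open import Data.Nat.Primality using (Prime; _Rough_; prime⇒nonZero; prime⇒irreducible; rough∧∣⇒prime)
  open import Data.Nat.Divisibility.Core using (hasNonTrivialDivisor)
  open import Data.Nat.Induction using (<-rec)
  open import Data.List.Base using (length; filter; upTo)
  open import Algebra.Properties.CommutativeSemigroup *-commutativeSemigroup using (interchange)

  Least : ∀ {p} → Pred ℕ p → Pred ℕ p
  Least P m = P m × (∀ {j} → j < m → ¬ P j)

  least : ∀ {p} {P : Pred ℕ p} → Decidable P → ∀ {n} → P n → ∃ (Least P)
  least P? {n} Pn with P? 0
  ... | yes P0 = 0 , P0 , λ ()
  least P? {zero}  Pn | no ¬P0 = contradiction Pn ¬P0
  least P? {suc n} Pn | no ¬P0 with least (P? ∘ suc) Pn
  ... | m , Pm , below = suc m , Pm , λ { {zero} _ → ¬P0 ; {suc j} (s≤s j<m) → below j<m }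

  ^-distribʳ-* : ∀ m n k → (m * n) ^ k ≡ m ^ k * n ^ k
  ^-distribʳ-* m n zero    = refl
  ^-distribʳ-* m n (suc k) = trans (cong ((m * n) *_) (^-distribʳ-* m n k)) (interchange m n (m ^ k) (n ^ k))

  n<2^n : ∀ n → n < 2 ^ n
  n<2^n zero    = z<s
  n<2^n (suc n) = begin-strict
    suc n            <⟨ +-mono-≤ (m^n>0 2 n) (n<2^n n) ⟩
    2 ^ n + 2 ^ n    ≡⟨ cong (2 ^ n +_) (+-identityʳ (2 ^ n)) ⟨
    2 ^ suc n        ∎
    where open ≤-Reasoning

  m≤m^[1+n] : ∀ m n .{{_ : NonZero m}} → m ≤ m ^ suc n
  m≤m^[1+n] m n = m≤m*n m (m ^ n) {{m^n≢0 m n}}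

  dyadic-bracket : ∀ n .{{_ : NonZero n}} → ∃[ k ] 2 ^ k ≤ n × n < 2 ^ suc k
  dyadic-bracket n with least (λ k → n <? 2 ^ suc k) {n} (<-≤-trans (n<2^n n) (^-monoʳ-≤ 2 (n≤1+n n)))
  ... | zero  , n<2       , _     = 0 , >-nonZero⁻¹ n , n<2
  ... | suc k , n<2^[2+k] , below = suc k , ≮⇒≥ (below ≤-refl) , n<2^[2+k]

  ∣-*-split : ∀ {d x y} .{{_ : NonZero x}} → d ∣ x * y → ∃₂ λ a b → a ∣ x × b ∣ y × a * b ≡ d
  ∣-*-split {d} {x} {y} d∣xy = g , d / g , gcd[m,n]∣n d x , d/g∣y , m*[n/m]≡n (gcd[m,n]∣m d x)
    where
    g = gcd d x
    instance
      g≢0 : NonZero g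
      g≢0 = ≢-nonZero (gcd[m,n]≢0 d x (inj₂ (≢-nonZero⁻¹ x)))
    g*d/g∣g*x/g*y : g * (d / g) ∣ g * ((x / g) * y)
    g*d/g∣g*x/g*y = subst₂ _∣_ (sym (m*[n/m]≡n (gcd[m,n]∣m d x)))
      (trans (cong (_* y) (sym (m*[n/m]≡n (gcd[m,n]∣n d x)))) (*-assoc g (x / g) y)) d∣xy
    d/g∣y : d / g ∣ y
    d/g∣y = coprime-divisor (coprime-/gcd d x) (*-cancelˡ-∣ g g*d/g∣g*x/g*y)

  ∣p^⇒≡p^ : ∀ {p d} → Prime p → ∀ k → d ∣ p ^ k → ∃[ j ] j ≤ k × p ^ j ≡ d
  ∣p^⇒≡p^ pr zero d∣1 = 0 , z≤n , sym (∣1⇒≡1 d∣1)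
  ∣p^⇒≡p^ {p} {d} pr (suc k) d∣p^[1+k] with p ∣? d
  ... | yes (divides e refl) =
    let instance _ = prime⇒nonZero pr
        j , j≤k , p^j≡e = ∣p^⇒≡p^ pr k (*-cancelˡ-∣ p (subst (_∣ p ^ suc k) (*-comm e p) d∣p^[1+k]))
    in suc j , s≤s j≤k , trans (cong (p *_) p^j≡e) (*-comm p e)
  ... | no p∤d with prime⇒irreducible pr (gcd[m,n]∣n d p)
  ...   | inj₂ gcd≡p = contradiction (subst (_∣ d) gcd≡p (gcd[m,n]∣m d p)) p∤d
  ...   | inj₁ gcd≡1 =
    let j , j≤k , p^j≡d = ∣p^⇒≡p^ pr k (coprime-divisor (gcd≡1⇒coprime gcd≡1) d∣p^[1+k])
    in j , m≤n⇒m≤1+n j≤k , p^j≡d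

  p-adic-split : ∀ {p} → 1 < p → ∀ q .{{_ : NonZero q}} → ∃₂ λ k m → p ∤ m × p ^ k * m ≡ q
  p-adic-split {p} 1<p = <-rec Split split
    where
    Split : ℕ → Set
    Split q = .{{NonZero q}} → ∃₂ λ k m → p ∤ m × p ^ k * m ≡ q
    split : ∀ q → (∀ {q′} → q′ < q → Split q′) → Split q
    split q rec with p ∣? q
    ... | no p∤q  = 0 , q , p∤q , *-identityˡ q
    ... | yes p∣q =
      let instance _ = n>1⇒nonTrivial 1<p
                   _ = quotient≢0 p∣q
          k , m , p∤m , p^k*m≡q′ = rec (quotient-< p∣q)
      in suc k , m , p∤m , (begin
        p * p ^ k * m      ≡⟨ *-assoc p (p ^ k) m ⟩
        p * (p ^ k * m)    ≡⟨ cong (p *_) p^k*m≡q′ ⟩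
        p * quotient p∣q   ≡⟨ m∣n⇒n≡m*quotient p∣q ⟨
        q                  ∎)
      where open ≡-Reasoning

  least-prime-factor : ∀ q → 1 < q → ∃[ p ] Prime p × p ∣ q × p Rough q
  least-prime-factor q 1<q with least (λ d → 1 <? d ×-dec d ∣? q) (1<q , ∣-refl)
  ... | p , (1<p , p∣q) , below = p , rough∧∣⇒prime p-rough p∣q , p∣q , p-rough
    where
    instance _ = n>1⇒nonTrivial 1<p
    p-rough : p Rough q
    p-rough (hasNonTrivialDivisor d<p d∣q) = below d<p (nonTrivial⇒n>1 _ , d∣q)

  -- Counts the divisors of n among 0, 1, …, n, which are all of them unless n = 0.
  τ : ℕ → ℕ
  τ n = length (filter (_∣? n) (upTo (suc n)))

module Sums where

  open import Data.Nat as ℕ using (ℕ; zero; suc; z≤n; s≤s)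
  import Data.Nat.Properties as ℕ
  open import Data.Nat.Divisibility using (_∣?_; ∣⇒≤; quotient; m∣n⇒n≡m*quotient)
  open import Data.Nat.GCD using (gcd; gcd[m,n]∣m; gcd[m,n]∣n; gcd[m,n]≢0; gcd[m,n]≤n)
  open import Data.Nat.Primality using (Prime)
  open import Data.Integer as ℤ using (+_)
  import Data.Integer.Properties as ℤ
  open import Data.Rational using (ℚ; 0ℚ; 1ℚ; _+_; _*_; _/_; _≤_; toℚᵘ; nonNegative)
  open import Data.Rational.Properties
  import Data.Rational.Unnormalised as ℚᵘ
  import Data.Rational.Unnormalised.Properties as ℚᵘ
  open import Data.Bool.Base using (if_then_else_)
  open import Data.Fin.Base using (toℕ)
  open import Data.List.Base using (List; []; _∷_; length; map; filter; applyUpTo; upTo)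
  open import Algebra.Bundles using (CommutativeRing; CommutativeMonoid)
  open import Algebra.Properties.Semiring.Sum (CommutativeRing.semiring +-*-commutativeRing)
    using (sum; ∑-comm; *-distribˡ-sum; *-distribʳ-sum; sum-replicate-zero)
  open import Algebra.Properties.CommutativeSemigroup (CommutativeMonoid.commutativeSemigroup *-1-commutativeMonoid)
    using () renaming (interchange to *-interchange)
  open Arithmetic using (τ; ∣-*-split; ∣p^⇒≡p^)

  fromℕ : ℕ → ℚ
  fromℕ n = + n / 1

  private
    toℚᵘ-/ : ∀ m d → toℚᵘ (+ m / suc d) ℚᵘ.≃ ℚᵘ.mkℚᵘ (+ m) d
    toℚᵘ-/ m d = toℚᵘ-fromℚᵘ (ℚᵘ.mkℚᵘ (+ m) d)

  /-mono-≤ : ∀ m d m′ d′ → m ℕ.* suc d′ ℕ.≤ m′ ℕ.* suc d → + m / suc d ≤ + m′ / suc d′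
  /-mono-≤ m d m′ d′ le = toℚᵘ-cancel-≤
    (ℚᵘ.≤-respˡ-≃ (ℚᵘ.≃-sym (toℚᵘ-/ m d)) (ℚᵘ.≤-respʳ-≃ (ℚᵘ.≃-sym (toℚᵘ-/ m′ d′))
      (ℚᵘ.*≤* (subst₂ ℤ._≤_ (ℤ.pos-* m (suc d′)) (ℤ.pos-* m′ (suc d)) (ℤ.+≤+ le)))))

  /-cancel-≤ : ∀ m d m′ d′ → + m / suc d ≤ + m′ / suc d′ → m ℕ.* suc d′ ℕ.≤ m′ ℕ.* suc d
  /-cancel-≤ m d m′ d′ le
    with ℚᵘ.≤-respˡ-≃ (toℚᵘ-/ m d) (ℚᵘ.≤-respʳ-≃ (toℚᵘ-/ m′ d′) (toℚᵘ-mono-≤ le))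
  ... | ℚᵘ.*≤* le′ = ℤ.drop‿+≤+ (subst₂ ℤ._≤_ (sym (ℤ.pos-* m (suc d′))) (sym (ℤ.pos-* m′ (suc d))) le′)

  /-cong-cross : ∀ m d m′ d′ → m ℕ.* suc d′ ≡ m′ ℕ.* suc d → + m / suc d ≡ + m′ / suc d′
  /-cong-cross m d m′ d′ eq =
    ≤-antisym (/-mono-≤ m d m′ d′ (ℕ.≤-reflexive eq)) (/-mono-≤ m′ d′ m d (ℕ.≤-reflexive (sym eq)))

  /-homo-* : ∀ m d m′ d′ → + m / suc d * (+ m′ / suc d′) ≡ + (m ℕ.* m′) / (suc d ℕ.* suc d′)
  /-homo-* m d m′ d′ = toℚᵘ-injective (begin
    toℚᵘ (+ m / suc d * (+ m′ / suc d′))           ≈⟨ toℚᵘ-homo-* (+ m / suc d) (+ m′ / suc d′) ⟩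
    toℚᵘ (+ m / suc d) ℚᵘ.* toℚᵘ (+ m′ / suc d′)   ≈⟨ ℚᵘ.*-cong (toℚᵘ-/ m d) (toℚᵘ-/ m′ d′) ⟩
    ℚᵘ.mkℚᵘ (+ m ℤ.* + m′) e                       ≡⟨ cong (λ i → ℚᵘ.mkℚᵘ i e) (ℤ.pos-* m m′) ⟨
    ℚᵘ.mkℚᵘ (+ (m ℕ.* m′)) e                       ≈⟨ toℚᵘ-/ (m ℕ.* m′) e ⟨
    toℚᵘ (+ (m ℕ.* m′) / (suc d ℕ.* suc d′))       ∎)
    where
    open ℚᵘ.≃-Reasoning
    e = d′ ℕ.+ d ℕ.* suc d′

  fromℕ-homo-+ : ∀ m n → fromℕ (m ℕ.+ n) ≡ fromℕ m + fromℕ n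
  fromℕ-homo-+ m n = toℚᵘ-injective (begin
    toℚᵘ (fromℕ (m ℕ.+ n))                ≈⟨ toℚᵘ-/ (m ℕ.+ n) 0 ⟩
    ℚᵘ.mkℚᵘ (+ (m ℕ.+ n)) 0                ≡⟨ cong (λ i → ℚᵘ.mkℚᵘ i 0) (ℤ.pos-+ m n) ⟩
    ℚᵘ.mkℚᵘ (+ m ℤ.+ + n) 0                ≡⟨ cong (λ i → ℚᵘ.mkℚᵘ i 0) (cong₂ ℤ._+_ (ℤ.*-identityʳ (+ m))
                                                                                 (ℤ.*-identityʳ (+ n))) ⟨
    ℚᵘ.mkℚᵘ (+ m) 0 ℚᵘ.+ ℚᵘ.mkℚᵘ (+ n) 0   ≈⟨ ℚᵘ.+-cong (toℚᵘ-/ m 0) (toℚᵘ-/ n 0) ⟨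
    toℚᵘ (fromℕ m) ℚᵘ.+ toℚᵘ (fromℕ n)     ≈⟨ toℚᵘ-homo-+ (fromℕ m) (fromℕ n) ⟨
    toℚᵘ (fromℕ m + fromℕ n)               ∎)
    where open ℚᵘ.≃-Reasoning

  fromℕ-homo-* : ∀ m n → fromℕ (m ℕ.* n) ≡ fromℕ m * fromℕ n
  fromℕ-homo-* m n = sym (/-homo-* m 0 n 0)

  fromℕ-mono-≤ : ∀ {m n} → m ℕ.≤ n → fromℕ m ≤ fromℕ n
  fromℕ-mono-≤ {m} {n} m≤n = /-mono-≤ m 0 n 0 (ℕ.*-monoˡ-≤ 1 m≤n)

  fromℕ-cancel-≤ : ∀ {m n} → fromℕ m ≤ fromℕ n → m ℕ.≤ n
  fromℕ-cancel-≤ {m} {n} le = ℕ.*-cancelʳ-≤ m n 1 (/-cancel-≤ m 0 n 0 le)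

  fromℕ-nonNeg : ∀ n → 0ℚ ≤ fromℕ n
  fromℕ-nonNeg n = fromℕ-mono-≤ (z≤n {n})

  recip-homo-* : ∀ m n → recip (m ℕ.* n) ≡ recip m * recip n
  recip-homo-* zero    n       = sym (*-zeroˡ (recip n))
  recip-homo-* (suc m) zero    = trans (cong recip (ℕ.*-zeroʳ m)) (sym (*-zeroʳ (recip (suc m))))
  recip-homo-* (suc m) (suc n) = sym (/-homo-* 1 m 1 n)

  recip-antimono-≤ : ∀ {m n} .{{_ : ℕ.NonZero m}} → m ℕ.≤ n → recip n ≤ recip m
  recip-antimono-≤ {suc m} {suc n} m≤n = /-mono-≤ 1 n 1 m (ℕ.*-monoʳ-≤ 1 m≤n)

  recip-nonNeg : ∀ n → 0ℚ ≤ recip n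
  recip-nonNeg zero    = ≤-refl
  recip-nonNeg (suc n) = /-mono-≤ 0 0 1 n z≤n

  fromℕ*recip≡1 : ∀ n .{{_ : ℕ.NonZero n}} → fromℕ n * recip n ≡ 1ℚ
  fromℕ*recip≡1 (suc n) = trans (/-homo-* (suc n) 0 1 n) (/-cong-cross (suc n ℕ.* 1) (n ℕ.+ 0 ℕ.* suc n) 1 0 cross)
    where
    cross : suc n ℕ.* 1 ℕ.* 1 ≡ 1 ℕ.* (1 ℕ.* suc n)
    cross = trans (ℕ.*-identityʳ _) (trans (ℕ.*-identityʳ (suc n)) (sym (trans (ℕ.*-identityˡ _) (ℕ.*-identityˡ (suc n)))))

  *-nonNeg : ∀ {p q} → 0ℚ ≤ p → 0ℚ ≤ q → 0ℚ ≤ p * q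
  *-nonNeg {p} {q} 0≤p 0≤q = nonNegative⁻¹ _ {{nonNeg*nonNeg⇒nonNeg p {{nonNegative 0≤p}} q {{nonNegative 0≤q}}}}

  *-monoˡ-≤-0≤ : ∀ {r p q} → 0ℚ ≤ r → p ≤ q → r * p ≤ r * q
  *-monoˡ-≤-0≤ {r} 0≤r = *-monoˡ-≤-nonNeg r {{nonNegative 0≤r}}

  *-monoʳ-≤-0≤ : ∀ {r p q} → 0ℚ ≤ r → p ≤ q → p * r ≤ q * r
  *-monoʳ-≤-0≤ {r} 0≤r = *-monoʳ-≤-nonNeg r {{nonNegative 0≤r}}

  *-mono-≤-0≤ : ∀ {p q r s} → 0ℚ ≤ p → 0ℚ ≤ r → p ≤ q → r ≤ s → p * r ≤ q * s
  *-mono-≤-0≤ 0≤p 0≤r p≤q r≤s = ≤-trans (*-monoʳ-≤-0≤ 0≤r p≤q) (*-monoˡ-≤-0≤ (≤-trans 0≤p p≤q) r≤s)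

  ^ℚ-nonNeg : ∀ {p} n → 0ℚ ≤ p → 0ℚ ≤ p ^ℚ n
  ^ℚ-nonNeg zero    0≤p = fromℕ-nonNeg 1
  ^ℚ-nonNeg (suc n) 0≤p = *-nonNeg 0≤p (^ℚ-nonNeg n 0≤p)

  ^ℚ-mono-≤ : ∀ {p q} n → 0ℚ ≤ p → p ≤ q → p ^ℚ n ≤ q ^ℚ n
  ^ℚ-mono-≤ zero    0≤p p≤q = ≤-refl
  ^ℚ-mono-≤ (suc n) 0≤p p≤q = *-mono-≤-0≤ 0≤p (^ℚ-nonNeg n 0≤p) p≤q (^ℚ-mono-≤ n 0≤p p≤q)

  ^ℚ-distrib-* : ∀ p q n → (p * q) ^ℚ n ≡ p ^ℚ n * q ^ℚ n
  ^ℚ-distrib-* p q zero    = refl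
  ^ℚ-distrib-* p q (suc n) =
    trans (cong ((p * q) *_) (^ℚ-distrib-* p q n)) (*-interchange p q (p ^ℚ n) (q ^ℚ n))

  *-homo⇒^-homo : (f : ℕ → ℚ) → f 1 ≡ 1ℚ → (∀ m n → f (m ℕ.* n) ≡ f m * f n) →
                  ∀ m n → f (m ℕ.^ n) ≡ f m ^ℚ n
  *-homo⇒^-homo f f1≡1 f-* m zero    = f1≡1
  *-homo⇒^-homo f f1≡1 f-* m (suc n) =
    trans (f-* m (m ℕ.^ n)) (cong (f m *_) (*-homo⇒^-homo f f1≡1 f-* m n))

  fromℕ-homo-^ : ∀ m n → fromℕ (m ℕ.^ n) ≡ fromℕ m ^ℚ n
  fromℕ-homo-^ = *-homo⇒^-homo fromℕ refl fromℕ-homo-*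

  recip-homo-^ : ∀ m n → recip (m ℕ.^ n) ≡ recip m ^ℚ n
  recip-homo-^ = *-homo⇒^-homo recip refl recip-homo-*

  recip^ℚ*fromℕ-≤ : ∀ g n {y z} .{{_ : ℕ.NonZero g}} →
                    y ℕ.≤ g ℕ.^ n ℕ.* z → recip g ^ℚ n * fromℕ y ≤ fromℕ z
  recip^ℚ*fromℕ-≤ g n {y} {z} y≤g^n*z = begin
    recip g ^ℚ n * fromℕ y          ≡⟨ cong (_* fromℕ y) (recip-homo-^ g n) ⟨
    recip G * fromℕ y               ≤⟨ *-monoˡ-≤-0≤ (recip-nonNeg G) (fromℕ-mono-≤ y≤g^n*z) ⟩
    recip G * fromℕ (G ℕ.* z)       ≡⟨ cong (recip G *_) (fromℕ-homo-* G z) ⟩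
    recip G * (fromℕ G * fromℕ z)   ≡⟨ *-assoc (recip G) (fromℕ G) (fromℕ z) ⟨
    recip G * fromℕ G * fromℕ z     ≡⟨ cong (_* fromℕ z) (trans (*-comm (recip G) (fromℕ G)) (fromℕ*recip≡1 G)) ⟩
    1ℚ * fromℕ z                    ≡⟨ *-identityˡ (fromℕ z) ⟩
    fromℕ z                         ∎
    where
    open ≤-Reasoning
    G = g ℕ.^ n
    instance _ = ℕ.m^n≢0 g n

  ^ℚ*fromℕ-≤ : ∀ {S} T g n {y z} .{{_ : ℕ.NonZero g}} → 0ℚ ≤ S → S ≤ fromℕ T * recip g →
               y ℕ.≤ g ℕ.^ n ℕ.* z → S ^ℚ n * fromℕ y ≤ fromℕ (T ℕ.^ n ℕ.* z)
  ^ℚ*fromℕ-≤ {S} T g n {y} {z} 0≤S S≤T/g y≤g^n*z = begin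
    S ^ℚ n * fromℕ y                          ≤⟨ *-monoʳ-≤-0≤ (fromℕ-nonNeg y) (^ℚ-mono-≤ n 0≤S S≤T/g) ⟩
    (fromℕ T * recip g) ^ℚ n * fromℕ y        ≡⟨ cong (_* fromℕ y) (^ℚ-distrib-* (fromℕ T) (recip g) n) ⟩
    fromℕ T ^ℚ n * recip g ^ℚ n * fromℕ y     ≡⟨ *-assoc (fromℕ T ^ℚ n) (recip g ^ℚ n) (fromℕ y) ⟩
    fromℕ T ^ℚ n * (recip g ^ℚ n * fromℕ y)   ≤⟨ *-monoˡ-≤-0≤ (^ℚ-nonNeg n (fromℕ-nonNeg T)) (recip^ℚ*fromℕ-≤ g n y≤g^n*z) ⟩
    fromℕ T ^ℚ n * fromℕ z                    ≡⟨ cong (_* fromℕ z) (fromℕ-homo-^ T n) ⟨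
    fromℕ (T ℕ.^ n) * fromℕ z                 ≡⟨ fromℕ-homo-* (T ℕ.^ n) z ⟨
    fromℕ (T ℕ.^ n ℕ.* z)                     ∎
    where open ≤-Reasoning

  𝟙 : ∀ {p} {P : Set p} → Dec P → ℚ
  𝟙 d = if does d then 1ℚ else 0ℚ

  𝟙-nonNeg : ∀ {p} {P : Set p} (d : Dec P) → 0ℚ ≤ 𝟙 d
  𝟙-nonNeg (yes _) = fromℕ-nonNeg 1
  𝟙-nonNeg (no _)  = ≤-refl

  𝟙-yes : ∀ {p} {P : Set p} (d : Dec P) → P → 𝟙 d ≡ 1ℚ
  𝟙-yes (yes _) _ = refl
  𝟙-yes (no ¬p) p = contradiction p ¬p

  ∑ : ℕ → (ℕ → ℚ) → ℚ
  ∑ n f = sum {n} (f ∘ toℕ)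

  syntax ∑ n (λ i → x) = ∑[ i < n ] x

  ∑-cong : ∀ n {f g : ℕ → ℚ} → (∀ i → i ℕ.< n → f i ≡ g i) → ∑ n f ≡ ∑ n g
  ∑-cong zero    f≡g = refl
  ∑-cong (suc n) f≡g = cong₂ _+_ (f≡g 0 ℕ.z<s) (∑-cong n (λ i i<n → f≡g (suc i) (s≤s i<n)))

  ∑-mono-≤ : ∀ n {f g : ℕ → ℚ} → (∀ i → i ℕ.< n → f i ≤ g i) → ∑ n f ≤ ∑ n g
  ∑-mono-≤ zero    f≤g = ≤-refl
  ∑-mono-≤ (suc n) f≤g = +-mono-≤ (f≤g 0 ℕ.z<s) (∑-mono-≤ n (λ i i<n → f≤g (suc i) (s≤s i<n)))

  ∑-nonNeg : ∀ n {f : ℕ → ℚ} → (∀ i → i ℕ.< n → 0ℚ ≤ f i) → 0ℚ ≤ ∑ n f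
  ∑-nonNeg n {f} 0≤f = subst (_≤ ∑ n f) (sum-replicate-zero n) (∑-mono-≤ n 0≤f)

  ≤-∑ : ∀ {n} {f : ℕ → ℚ} → (∀ i → i ℕ.< n → 0ℚ ≤ f i) → ∀ {i} → i ℕ.< n → f i ≤ ∑ n f
  ≤-∑ {suc n} {f} 0≤f {zero} _ = begin
    f 0                         ≡⟨ +-identityʳ (f 0) ⟨
    f 0 + 0ℚ                    ≤⟨ +-monoʳ-≤ (f 0) (∑-nonNeg n (λ i i<n → 0≤f (suc i) (s≤s i<n))) ⟩
    ∑ (suc n) f                 ∎
    where open ≤-Reasoning
  ≤-∑ {suc n} {f} 0≤f {suc i} (s≤s i<n) = begin
    f (suc i)                   ≤⟨ ≤-∑ (λ j j<n → 0≤f (suc j) (s≤s j<n)) i<n ⟩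
    ∑[ j < n ] f (suc j)        ≡⟨ +-identityˡ _ ⟨
    0ℚ + ∑[ j < n ] f (suc j)   ≤⟨ +-monoˡ-≤ _ (0≤f 0 ℕ.z<s) ⟩
    ∑ (suc n) f                 ∎
    where open ≤-Reasoning

  ∑-split : ∀ m n (f : ℕ → ℚ) → ∑ (m ℕ.+ n) f ≡ ∑ m f + ∑[ i < n ] f (m ℕ.+ i)
  ∑-split zero    n f = sym (+-identityˡ _)
  ∑-split (suc m) n f = trans (cong (_+_ (f 0)) (∑-split m n (f ∘ suc))) (sym (+-assoc (f 0) _ _))

  ∑-const : ∀ n c → ∑[ _ < n ] c ≡ fromℕ n * c
  ∑-const zero    c = sym (*-zeroˡ c)
  ∑-const (suc n) c = begin
    c + ∑[ _ < n ] c       ≡⟨ cong₂ _+_ (sym (*-identityˡ c)) (∑-const n c) ⟩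
    1ℚ * c + fromℕ n * c   ≡⟨ *-distribʳ-+ c 1ℚ (fromℕ n) ⟨
    (1ℚ + fromℕ n) * c     ≡⟨ cong (_* c) (fromℕ-homo-+ 1 n) ⟨
    fromℕ (suc n) * c      ∎
    where open ≡-Reasoning

  ∑-product : ∀ m l (f g : ℕ → ℚ) → ∑[ i < m ] ∑[ j < l ] (f i * g j) ≡ ∑ m f * ∑ l g
  ∑-product m l f g = begin
    ∑[ i < m ] ∑[ j < l ] (f i * g j)   ≡⟨ ∑-cong m (λ i _ → *-distribˡ-sum {l} (f i) (g ∘ toℕ)) ⟨
    ∑[ i < m ] (f i * ∑ l g)            ≡⟨ *-distribʳ-sum {m} (∑ l g) (f ∘ toℕ) ⟨
    ∑ m f * ∑ l g                       ∎
    where open ≡-Reasoning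

  -- 𝟙 looks only at `does`, so 𝟙 (0 ≟ suc i) is 0ℚ and 𝟙 (suc t ≟ suc i) is 𝟙 (t ≟ i) by computation.
  ∑-indicator-≤ : ∀ n t → ∑[ i < n ] 𝟙 (t ℕ.≟ i) ≤ 1ℚ
  ∑-indicator-≤ zero    t       = fromℕ-nonNeg 1
  ∑-indicator-≤ (suc n) zero    = ≤-reflexive (trans (cong (_+_ 1ℚ) (sum-replicate-zero n)) (+-identityʳ 1ℚ))
  ∑-indicator-≤ (suc n) (suc t) = ≤-trans (≤-reflexive (+-identityˡ (∑[ i < n ] 𝟙 (t ℕ.≟ i)))) (∑-indicator-≤ n t)

  -- Each term v g j of the double sum carries the single label `label g j`, so it dominates at most one w i.
  ∑-≤-cover : ∀ n m l (w : ℕ → ℚ) (v : ℕ → ℕ → ℚ) (label : ℕ → ℕ → ℕ) → (∀ g j → 0ℚ ≤ v g j) →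
              (∀ i → i ℕ.< n → w i ≤ 0ℚ ⊎ ∃₂ λ g j → g ℕ.< m × j ℕ.< l × label g j ≡ i × w i ≤ v g j) →
              ∑ n w ≤ ∑[ g < m ] ∑[ j < l ] v g j
  ∑-≤-cover n m l w v label 0≤v covered = begin
    ∑ n w                                        ≤⟨ ∑-mono-≤ n dominated ⟩
    ∑[ i < n ] ∑[ g < m ] ∑[ j < l ] hit g j i   ≡⟨ ∑-comm {n} {m} (λ i g → ∑[ j < l ] hit (toℕ g) j (toℕ i)) ⟩
    ∑[ g < m ] ∑[ i < n ] ∑[ j < l ] hit g j i   ≡⟨ ∑-cong m (λ g _ → ∑-comm {n} {l} (λ i j → hit g (toℕ j) (toℕ i))) ⟩
    ∑[ g < m ] ∑[ j < l ] ∑[ i < n ] hit g j i   ≤⟨ ∑-mono-≤ m (λ g _ → ∑-mono-≤ l (λ j _ → hits≤ g j)) ⟩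
    ∑[ g < m ] ∑[ j < l ] v g j                  ∎
    where
    open ≤-Reasoning
    hit : ℕ → ℕ → ℕ → ℚ
    hit g j i = 𝟙 (label g j ℕ.≟ i) * v g j

    hit-nonNeg : ∀ g j i → 0ℚ ≤ hit g j i
    hit-nonNeg g j i = *-nonNeg (𝟙-nonNeg (label g j ℕ.≟ i)) (0≤v g j)

    hits≤ : ∀ g j → ∑[ i < n ] hit g j i ≤ v g j
    hits≤ g j = begin
      ∑[ i < n ] hit g j i                       ≡⟨ *-distribʳ-sum {n} (v g j) (λ i → 𝟙 (label g j ℕ.≟ toℕ i)) ⟨
      (∑[ i < n ] 𝟙 (label g j ℕ.≟ i)) * v g j   ≤⟨ *-monoʳ-≤-0≤ (0≤v g j) (∑-indicator-≤ n (label g j)) ⟩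
      1ℚ * v g j                                 ≡⟨ *-identityˡ (v g j) ⟩
      v g j                                      ∎

    dominated : ∀ i → i ℕ.< n → w i ≤ ∑[ g < m ] ∑[ j < l ] hit g j i
    dominated i i<n with covered i i<n
    ... | inj₁ w≤0 = ≤-trans w≤0 (∑-nonNeg m (λ g _ → ∑-nonNeg l (λ j _ → hit-nonNeg g j i)))
    ... | inj₂ (g , j , g<m , j<l , refl , w≤v) = begin
      w i                                   ≤⟨ w≤v ⟩
      v g j                                 ≡⟨ *-identityˡ (v g j) ⟨
      1ℚ * v g j                            ≡⟨ cong (_* v g j) (𝟙-yes (i ℕ.≟ i) refl) ⟨
      hit g j i                             ≤⟨ ≤-∑ (λ j′ _ → hit-nonNeg g j′ i) j<l ⟩
      ∑[ j′ < l ] hit g j′ i                ≤⟨ ≤-∑ (λ g′ _ → ∑-nonNeg l (λ j′ _ → hit-nonNeg g′ j′ i)) g<m ⟩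
      ∑[ g′ < m ] ∑[ j′ < l ] hit g′ j′ i   ∎

  sumℚ-filter : ∀ {p} {P : Pred ℕ p} (P? : Decidable P) (f : ℕ → ℚ) (g : ℕ → ℕ) n →
                sumℚ (map f (filter P? (applyUpTo g n))) ≡ ∑[ i < n ] (𝟙 (P? (g i)) * f (g i))
  sumℚ-filter P? f g zero = refl
  sumℚ-filter P? f g (suc n) with P? (g 0)
  ... | yes _ = cong₂ _+_ (sym (*-identityˡ (f (g 0)))) (sumℚ-filter P? f (g ∘ suc) n)
  ... | no _  = trans (sumℚ-filter P? f (g ∘ suc) n)
                  (sym (trans (cong (_+ rest) (*-zeroˡ (f (g 0)))) (+-identityˡ rest)))
    where rest = ∑[ i < n ] (𝟙 (P? (g (suc i))) * f (g (suc i)))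

  fromℕ-length : ∀ {a} {A : Set a} (xs : List A) → fromℕ (length xs) ≡ sumℚ (map (λ _ → 1ℚ) xs)
  fromℕ-length []       = refl
  fromℕ-length (x ∷ xs) = trans (fromℕ-homo-+ 1 (length xs)) (cong (_+_ 1ℚ) (fromℕ-length xs))

  fromℕ-τ : ∀ n → fromℕ (τ n) ≡ ∑[ d < suc n ] 𝟙 (d ∣? n)
  fromℕ-τ n = begin
    fromℕ (τ n)                        ≡⟨ fromℕ-length divisors ⟩
    sumℚ (map (λ _ → 1ℚ) divisors)     ≡⟨ sumℚ-filter (_∣? n) (λ _ → 1ℚ) (λ d → d) (suc n) ⟩
    ∑[ d < suc n ] (𝟙 (d ∣? n) * 1ℚ)   ≡⟨ ∑-cong (suc n) (λ d _ → *-identityʳ (𝟙 (d ∣? n))) ⟩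
    ∑[ d < suc n ] 𝟙 (d ∣? n)          ∎
    where
    open ≡-Reasoning
    divisors = filter (_∣? n) (upTo (suc n))

  τ-*-≤ : ∀ x y .{{_ : ℕ.NonZero x}} .{{_ : ℕ.NonZero y}} → τ (x ℕ.* y) ℕ.≤ τ x ℕ.* τ y
  τ-*-≤ x y = fromℕ-cancel-≤ {τ (x ℕ.* y)} {τ x ℕ.* τ y} (begin
    fromℕ (τ (x ℕ.* y))                                     ≡⟨ fromℕ-τ (x ℕ.* y) ⟩
    ∑[ d < suc (x ℕ.* y) ] 𝟙 (d ∣? x ℕ.* y)                 ≤⟨ ∑-≤-cover (suc (x ℕ.* y)) (suc x) (suc y) _ _ ℕ._*_
                                                                 (λ a b → *-nonNeg (𝟙-nonNeg (a ∣? x)) (𝟙-nonNeg (b ∣? y)))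
                                                                 split ⟩
    ∑[ a < suc x ] ∑[ b < suc y ] (𝟙 (a ∣? x) * 𝟙 (b ∣? y))  ≡⟨ ∑-product (suc x) (suc y) (λ a → 𝟙 (a ∣? x))
                                                                                           (λ b → 𝟙 (b ∣? y)) ⟩
    ∑[ a < suc x ] 𝟙 (a ∣? x) * ∑[ b < suc y ] 𝟙 (b ∣? y)    ≡⟨ cong₂ _*_ (fromℕ-τ x) (fromℕ-τ y) ⟨
    fromℕ (τ x) * fromℕ (τ y)                               ≡⟨ fromℕ-homo-* (τ x) (τ y) ⟨
    fromℕ (τ x ℕ.* τ y)                                     ∎)
    where
    open ≤-Reasoning
    split : ∀ d → d ℕ.< suc (x ℕ.* y) → 𝟙 (d ∣? x ℕ.* y) ≤ 0ℚ ⊎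
            ∃₂ λ a b → a ℕ.< suc x × b ℕ.< suc y × a ℕ.* b ≡ d ×
                       𝟙 (d ∣? x ℕ.* y) ≤ 𝟙 (a ∣? x) * 𝟙 (b ∣? y)
    split d _ with d ∣? x ℕ.* y
    ... | no _ = inj₁ ≤-refl
    ... | yes d∣xy with ∣-*-split d∣xy
    ...   | a , b , a∣x , b∣y , ab≡d = inj₂ (a , b , s≤s (∣⇒≤ a∣x) , s≤s (∣⇒≤ b∣y) , ab≡d ,
            ≤-reflexive (sym (cong₂ _*_ (𝟙-yes (a ∣? x) a∣x) (𝟙-yes (b ∣? y) b∣y))))

  τ-prime^-≤ : ∀ {p} → Prime p → ∀ k → τ (p ℕ.^ k) ℕ.≤ suc k
  τ-prime^-≤ {p} pr k = fromℕ-cancel-≤ {τ (p ℕ.^ k)} {suc k} (begin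
    fromℕ (τ (p ℕ.^ k))                      ≡⟨ fromℕ-τ (p ℕ.^ k) ⟩
    ∑[ d < suc (p ℕ.^ k) ] 𝟙 (d ∣? p ℕ.^ k)   ≤⟨ ∑-≤-cover (suc (p ℕ.^ k)) (suc k) 1 _ (λ _ _ → 1ℚ)
                                                  (λ j _ → p ℕ.^ j) (λ _ _ → fromℕ-nonNeg 1) power ⟩
    ∑[ j < suc k ] ∑[ _ < 1 ] 1ℚ             ≡⟨ ∑-const (suc k) 1ℚ ⟩
    fromℕ (suc k) * 1ℚ                       ≡⟨ *-identityʳ (fromℕ (suc k)) ⟩
    fromℕ (suc k)                            ∎)
    where
    open ≤-Reasoning
    power : ∀ d → d ℕ.< suc (p ℕ.^ k) → 𝟙 (d ∣? p ℕ.^ k) ≤ 0ℚ ⊎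
            ∃₂ λ j i → j ℕ.< suc k × i ℕ.< 1 × p ℕ.^ j ≡ d × 𝟙 (d ∣? p ℕ.^ k) ≤ 1ℚ
    power d _ with d ∣? p ℕ.^ k
    ... | no _ = inj₁ ≤-refl
    ... | yes d∣p^k with ∣p^⇒≡p^ pr k d∣p^k
    ...   | j , j≤k , p^j≡d = inj₂ (j , 0 , s≤s j≤k , ℕ.z<s , p^j≡d , ≤-refl)

  H : ℕ → ℚ
  H n = ∑[ j < n ] recip j

  H-mono-≤ : ∀ {m n} → m ℕ.≤ n → H m ≤ H n
  H-mono-≤ {m} {n} m≤n = begin
    H m                                      ≡⟨ +-identityʳ (H m) ⟨
    H m + 0ℚ                                 ≤⟨ +-monoʳ-≤ (H m) (∑-nonNeg (n ℕ.∸ m) (λ i _ → recip-nonNeg (m ℕ.+ i))) ⟩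
    H m + ∑[ i < n ℕ.∸ m ] recip (m ℕ.+ i)   ≡⟨ ∑-split m (n ℕ.∸ m) recip ⟨
    H (m ℕ.+ (n ℕ.∸ m))                      ≡⟨ cong H (ℕ.m+[n∸m]≡n m≤n) ⟩
    H n                                      ∎
    where open ≤-Reasoning

  H-double-≤ : ∀ m .{{_ : ℕ.NonZero m}} → H (m ℕ.+ m) ≤ H m + 1ℚ
  H-double-≤ m = begin
    H (m ℕ.+ m)                        ≡⟨ ∑-split m m recip ⟩
    H m + ∑[ i < m ] recip (m ℕ.+ i)   ≤⟨ +-monoʳ-≤ (H m) (∑-mono-≤ m (λ i _ → recip-antimono-≤ (ℕ.m≤m+n m i))) ⟩
    H m + ∑[ _ < m ] recip m           ≡⟨ cong (_+_ (H m)) (trans (∑-const m (recip m)) (fromℕ*recip≡1 m)) ⟩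
    H m + 1ℚ                           ∎
    where open ≤-Reasoning

  H-2^-≤ : ∀ k → H (2 ℕ.^ k) ≤ fromℕ k
  H-2^-≤ zero    = ≤-refl
  H-2^-≤ (suc k) = begin
    H (2 ℕ.^ suc k)           ≡⟨ cong (λ x → H (2 ℕ.^ k ℕ.+ x)) (ℕ.+-identityʳ (2 ℕ.^ k)) ⟩
    H (2 ℕ.^ k ℕ.+ 2 ℕ.^ k)   ≤⟨ H-double-≤ (2 ℕ.^ k) {{ℕ.m^n≢0 2 k}} ⟩
    H (2 ℕ.^ k) + 1ℚ          ≤⟨ +-monoˡ-≤ 1ℚ (H-2^-≤ k) ⟩
    fromℕ k + fromℕ 1         ≡⟨ fromℕ-homo-+ k 1 ⟨
    fromℕ (k ℕ.+ 1)           ≡⟨ cong fromℕ (ℕ.+-comm k 1) ⟩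
    fromℕ (suc k)             ∎
    where open ≤-Reasoning

  ∑-recip-gcd-≤ : ∀ N g₀ .{{_ : ℕ.NonZero N}} .{{_ : ℕ.NonZero g₀}} {c} {C : Pred ℕ c} (C? : Decidable C) →
                  (∀ {g} → C g → g₀ ℕ.≤ g) →
                  ∑[ r < N ] (𝟙 (C? (gcd r N)) * recip r) ≤ fromℕ (τ N) * (H (suc N) * recip g₀)
  ∑-recip-gcd-≤ N g₀ C? C⇒g₀≤ = begin
    ∑[ r < N ] (𝟙 (C? (gcd r N)) * recip r)          ≤⟨ ∑-≤-cover N (suc N) (suc N) _ v ℕ._*_ v-nonNeg split ⟩
    ∑[ g < suc N ] ∑[ j < suc N ] v g j              ≡⟨ ∑-product (suc N) (suc N) (λ g → 𝟙 (g ∣? N))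
                                                                                  (λ j → recip j * recip g₀) ⟩
    ∑[ g < suc N ] 𝟙 (g ∣? N) *
      ∑[ j < suc N ] (recip j * recip g₀)            ≡⟨ cong₂ _*_ (fromℕ-τ N)
                                                             (*-distribʳ-sum {suc N} (recip g₀) (recip ∘ toℕ)) ⟨
    fromℕ (τ N) * (H (suc N) * recip g₀)             ∎
    where
    open ≤-Reasoning
    v : ℕ → ℕ → ℚ
    v g j = 𝟙 (g ∣? N) * (recip j * recip g₀)

    v-nonNeg : ∀ g j → 0ℚ ≤ v g j
    v-nonNeg g j = *-nonNeg (𝟙-nonNeg (g ∣? N)) (*-nonNeg (recip-nonNeg j) (recip-nonNeg g₀))

    split : ∀ r → r ℕ.< N → 𝟙 (C? (gcd r N)) * recip r ≤ 0ℚ ⊎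
            ∃₂ λ g j → g ℕ.< suc N × j ℕ.< suc N × g ℕ.* j ≡ r × 𝟙 (C? (gcd r N)) * recip r ≤ v g j
    split zero _ = inj₁ (≤-reflexive (*-zeroʳ (𝟙 (C? (gcd 0 N)))))
    split r@(suc _) r<N with C? (gcd r N)
    ... | no _  = inj₁ (≤-reflexive (*-zeroˡ (recip r)))
    ... | yes c = inj₂ (g , j , s≤s (gcd[m,n]≤n r N) , s≤s (ℕ.≤-trans j≤r (ℕ.<⇒≤ r<N)) , g*j≡r , (begin
      1ℚ * recip r                ≡⟨ *-identityˡ (recip r) ⟩
      recip r                     ≡⟨ cong recip g*j≡r ⟨
      recip (g ℕ.* j)             ≡⟨ trans (recip-homo-* g j) (*-comm (recip g) (recip j)) ⟩
      recip j * recip g           ≤⟨ *-monoˡ-≤-0≤ (recip-nonNeg j) (recip-antimono-≤ (C⇒g₀≤ c)) ⟩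
      recip j * recip g₀          ≡⟨ *-identityˡ _ ⟨
      1ℚ * (recip j * recip g₀)   ≡⟨ cong (_* (recip j * recip g₀)) (𝟙-yes (g ∣? N) (gcd[m,n]∣n r N)) ⟨
      v g j                       ∎))
      where
      g = gcd r N
      g∣r = gcd[m,n]∣m r N
      j = quotient g∣r
      instance
        g≢0 : ℕ.NonZero g
        g≢0 = ℕ.≢-nonZero (gcd[m,n]≢0 r N (inj₁ (λ ())))
      g*j≡r : g ℕ.* j ≡ r
      g*j≡r = sym (m∣n⇒n≡m*quotient g∣r)
      j≤r : j ℕ.≤ r
      j≤r = subst (j ℕ.≤_) (trans (ℕ.*-comm j g) g*j≡r) (ℕ.m≤m*n j g)

module Growth (a b : ℕ) where

  open import Data.Nat
  open import Data.Nat.Properties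
  open import Data.Nat.Divisibility using (_∣_; divides)
  open import Data.Nat.DivMod using (_/_; _%_; m≡m%n+[m/n]*n; m%n<n; m/n*n≤m)
  open import Data.Nat.Induction using (<-rec)
  open import Data.Nat.Primality
    using (Prime; _Rough_; 0-rough; prime⇒nonZero; prime⇒nonTrivial; rough⇒≤; rough∧∣⇒rough; ∤⇒rough-suc)
  open import Data.Nat.Solver using (module +-*-Solver)
  open Arithmetic using (^-distribʳ-*; n<2^n; m≤m^[1+n]; p-adic-split; least-prime-factor; τ)
  open Sums using (τ-*-≤; τ-prime^-≤)

  -- (1 + k)^B ≤ M 2^k for all k, and (1 + k)^B ≤ p^k once p ≥ P₀; so each prime below P₀ costs at
  -- most a factor M in τ(q)^B / q^A, and K = M^P₀ covers all of them.
  A B M P₀ K : ℕ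
  A  = suc a
  B  = suc b
  M  = B ^ B
  P₀ = 2 ^ B
  K  = M ^ P₀

  instance
    M≢0 : NonZero M
    M≢0 = m^n≢0 B B

  [1+k]^B≤M*2^k : ∀ k → suc k ^ B ≤ M * 2 ^ k
  [1+k]^B≤M*2^k k = begin
    suc k ^ B          ≤⟨ ^-monoˡ-≤ B 1+k≤B*2^t ⟩
    (B * 2 ^ t) ^ B    ≡⟨ ^-distribʳ-* B (2 ^ t) B ⟩
    M * (2 ^ t) ^ B    ≡⟨ cong (M *_) (^-*-assoc 2 t B) ⟩
    M * 2 ^ (t * B)    ≤⟨ *-monoʳ-≤ M (^-monoʳ-≤ 2 (m/n*n≤m k B)) ⟩
    M * 2 ^ k          ∎
    where
    open ≤-Reasoning
    t = k / B
    1+k≤B*2^t : suc k ≤ B * 2 ^ t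
    1+k≤B*2^t = begin
      suc k                 ≡⟨ cong suc (m≡m%n+[m/n]*n k B) ⟩
      suc (k % B + t * B)   ≤⟨ +-monoˡ-≤ (t * B) (m%n<n k B) ⟩
      B + t * B             ≡⟨ *-comm (suc t) B ⟩
      B * suc t             ≤⟨ *-monoʳ-≤ B (n<2^n t) ⟩
      B * 2 ^ t             ∎

  [1+k]^B≤M*N^A : ∀ {k N} .{{_ : NonZero N}} → 2 ^ k ≤ N → suc k ^ B ≤ M * N ^ A
  [1+k]^B≤M*N^A {k} {N} 2^k≤N = ≤-trans ([1+k]^B≤M*2^k k) (*-monoʳ-≤ M (≤-trans 2^k≤N (m≤m^[1+n] N a)))

  prime-power-weight : ∀ {p} → 2 ≤ p → ∀ k → suc k ^ B * M ^ (P₀ ∸ suc p) ≤ M ^ (P₀ ∸ p) * (p ^ k) ^ A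
  prime-power-weight {p} 2≤p k with p <? P₀
  ... | yes p<P₀ = begin
    suc k ^ B * M ^ e           ≤⟨ *-monoˡ-≤ (M ^ e) (≤-trans ([1+k]^B≤M*2^k k) (*-monoʳ-≤ M 2^k≤[p^k]^A)) ⟩
    M * (p ^ k) ^ A * M ^ e     ≡⟨ *-comm (M * (p ^ k) ^ A) (M ^ e) ⟩
    M ^ e * (M * (p ^ k) ^ A)   ≡⟨ *-assoc (M ^ e) M ((p ^ k) ^ A) ⟨
    M ^ e * M * (p ^ k) ^ A     ≡⟨ cong (_* (p ^ k) ^ A) (*-comm (M ^ e) M) ⟩
    M ^ suc e * (p ^ k) ^ A     ≡⟨ cong (λ x → M ^ x * (p ^ k) ^ A) (+-∸-assoc 1 p<P₀) ⟨
    M ^ (P₀ ∸ p) * (p ^ k) ^ A  ∎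
    where
    open ≤-Reasoning
    e = P₀ ∸ suc p
    instance _ = m^n≢0 p k {{>-nonZero (≤-trans z<s 2≤p)}}
    2^k≤[p^k]^A : 2 ^ k ≤ (p ^ k) ^ A
    2^k≤[p^k]^A = ≤-trans (^-monoˡ-≤ k 2≤p) (m≤m^[1+n] (p ^ k) a)
  ... | no p≮P₀ = begin
    suc k ^ B * M ^ (P₀ ∸ suc p)   ≡⟨ cong (λ x → suc k ^ B * M ^ x) (m≤n⇒m∸n≡0 (m≤n⇒m≤1+n P₀≤p)) ⟩
    suc k ^ B * 1                  ≡⟨ *-identityʳ (suc k ^ B) ⟩
    suc k ^ B                      ≤⟨ ^-monoˡ-≤ B (n<2^n k) ⟩
    (2 ^ k) ^ B                    ≡⟨ ^-*-assoc 2 k B ⟩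
    2 ^ (k * B)                    ≡⟨ cong (2 ^_) (*-comm k B) ⟩
    2 ^ (B * k)                    ≡⟨ ^-*-assoc 2 B k ⟨
    P₀ ^ k                         ≤⟨ ^-monoˡ-≤ k P₀≤p ⟩
    p ^ k                          ≤⟨ m≤m^[1+n] (p ^ k) a ⟩
    (p ^ k) ^ A                    ≡⟨ *-identityˡ ((p ^ k) ^ A) ⟨
    1 * (p ^ k) ^ A                ≡⟨ cong (λ x → M ^ x * (p ^ k) ^ A) (m≤n⇒m∸n≡0 P₀≤p) ⟨
    M ^ (P₀ ∸ p) * (p ^ k) ^ A     ∎
    where
    open ≤-Reasoning
    P₀≤p = ≮⇒≥ p≮P₀
    instance _ = m^n≢0 p k {{>-nonZero (≤-trans z<s 2≤p)}}

  τ-prime^*-bound : ∀ {p k m P} → Prime p → P ≤ p → .{{_ : NonZero m}} →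
                    τ m ^ B ≤ M ^ (P₀ ∸ suc p) * m ^ A →
                    τ (p ^ k * m) ^ B ≤ M ^ (P₀ ∸ P) * (p ^ k * m) ^ A
  τ-prime^*-bound {p} {k} {m} {P} pr P≤p τm^B≤ = begin
    τ (p ^ k * m) ^ B                        ≤⟨ ^-monoˡ-≤ B τ[p^k*m]≤[1+k]*τm ⟩
    (suc k * τ m) ^ B                        ≡⟨ ^-distribʳ-* (suc k) (τ m) B ⟩
    suc k ^ B * τ m ^ B                      ≤⟨ *-monoʳ-≤ (suc k ^ B) τm^B≤ ⟩
    suc k ^ B * (M ^ (P₀ ∸ suc p) * m ^ A)   ≡⟨ *-assoc (suc k ^ B) _ _ ⟨
    suc k ^ B * M ^ (P₀ ∸ suc p) * m ^ A     ≤⟨ *-monoˡ-≤ (m ^ A) (prime-power-weight 2≤p k) ⟩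
    M ^ (P₀ ∸ p) * (p ^ k) ^ A * m ^ A       ≤⟨ *-monoˡ-≤ _ (*-monoˡ-≤ _ (^-monoʳ-≤ M (∸-monoʳ-≤ P₀ P≤p))) ⟩
    M ^ (P₀ ∸ P) * (p ^ k) ^ A * m ^ A       ≡⟨ *-assoc (M ^ (P₀ ∸ P)) _ _ ⟩
    M ^ (P₀ ∸ P) * ((p ^ k) ^ A * m ^ A)     ≡⟨ cong (M ^ (P₀ ∸ P) *_) (^-distribʳ-* (p ^ k) m A) ⟨
    M ^ (P₀ ∸ P) * (p ^ k * m) ^ A           ∎
    where
    open ≤-Reasoning
    instance _ = m^n≢0 p k {{prime⇒nonZero pr}}
    2≤p = nonTrivial⇒n>1 p {{prime⇒nonTrivial pr}}
    τ[p^k*m]≤[1+k]*τm : τ (p ^ k * m) ≤ suc k * τ m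
    τ[p^k*m]≤[1+k]*τm = ≤-trans (τ-*-≤ (p ^ k) m) (*-monoˡ-≤ (τ m) (τ-prime^-≤ pr k))

  -- The factor M^(P₀ ∸ P) pays for the primes of q below P₀, all of which are ≥ P. The induction on q
  -- splits off the least prime factor p ≥ P, leaving a (p + 1)-rough cofactor.
  τ^B≤-rough : ∀ q .{{_ : NonZero q}} P → P Rough q → τ q ^ B ≤ M ^ (P₀ ∸ P) * q ^ A
  τ^B≤-rough = <-rec Claim step
    where
    Claim : ℕ → Set
    Claim q = .{{NonZero q}} → ∀ P → P Rough q → τ q ^ B ≤ M ^ (P₀ ∸ P) * q ^ A
    step : ∀ q → (∀ {m} → m < q → Claim m) → Claim q
    step 1 _ P _ = begin
      τ 1 ^ B                ≡⟨ ^-zeroˡ B ⟩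
      1 * 1                  ≤⟨ *-mono-≤ (m^n>0 M (P₀ ∸ P)) (m^n>0 1 A) ⟩
      M ^ (P₀ ∸ P) * 1 ^ A   ∎
      where open ≤-Reasoning
    step q@(suc (suc _)) rec P P-rough with least-prime-factor q (s<s z<s)
    ... | p , p-prime , p∣q , p-rough with p-adic-split (nonTrivial⇒n>1 p {{prime⇒nonTrivial p-prime}}) q
    ...   | zero  , m , p∤m , 1*m≡q = contradiction (subst (p ∣_) (trans (sym 1*m≡q) (*-identityˡ m)) p∣q) p∤m
    ...   | suc k , m , p∤m , p^k*m≡q = subst (λ x → τ x ^ B ≤ M ^ (P₀ ∸ P) * x ^ A) p^k*m≡q
              (τ-prime^*-bound {k = suc k} p-prime P≤p (rec m<q (suc p) m-rough))
      where
      instance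
        _ = prime⇒nonTrivial p-prime
        m≢0 : NonZero m
        m≢0 = m*n≢0⇒n≢0 (p ^ suc k) {{subst NonZero (sym p^k*m≡q) _}}
      P≤p : P ≤ p
      P≤p = rough⇒≤ (rough∧∣⇒rough P-rough p∣q)
      m-rough : suc p Rough m
      m-rough = ∤⇒rough-suc p∤m (rough∧∣⇒rough p-rough (divides (p ^ suc k) (sym p^k*m≡q)))
      m<q : m < q
      m<q = subst (m <_) (trans (*-comm m (p ^ suc k)) p^k*m≡q)
              (m<m*n m (p ^ suc k) (<-≤-trans (nonTrivial⇒n>1 p) (m≤m^[1+n] p k {{prime⇒nonZero p-prime}})))

  τ^B≤K*q^A : ∀ q .{{_ : NonZero q}} → τ q ^ B ≤ K * q ^ A
  τ^B≤K*q^A q = τ^B≤-rough q 0 0-rough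

  exponent-bound : ∀ {t s N} → t ^ B ≤ K * N ^ A → s ^ B ≤ M * N ^ A →
                   (t * s) ^ (5 * B) * N ^ (5 * A) ≤ (K * M) ^ (5 * B) * N ^ (15 * A)
  exponent-bound {t} {s} {N} t^B≤ s^B≤ = begin
    (t * s) ^ (5 * B) * N ^ (5 * A)    ≡⟨ cong₂ _*_ (^-*-comm (t * s) 5 B) (^-*-comm N 5 A) ⟩
    ((t * s) ^ B) ^ 5 * z ^ 5          ≡⟨ cong (λ x → x ^ 5 * z ^ 5) (^-distribʳ-* t s B) ⟩
    (t ^ B * s ^ B) ^ 5 * z ^ 5        ≤⟨ *-monoˡ-≤ (z ^ 5) (^-monoˡ-≤ 5 (*-mono-≤ t^B≤ s^B≤)) ⟩
    (K * z * (M * z)) ^ 5 * z ^ 5      ≡⟨ solve 3 (λ k m x → (k :* x :* (m :* x)) :^ 5 :* x :^ 5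
                                                           := (k :* m) :^ 5 :* x :^ 15) refl K M z ⟩
    (K * M) ^ 5 * z ^ 15               ≤⟨ *-monoˡ-≤ (z ^ 15) (^-monoʳ-≤ (K * M) (m≤m*n 5 B)) ⟩
    (K * M) ^ (5 * B) * z ^ 15         ≡⟨ cong ((K * M) ^ (5 * B) *_) (^-*-comm N 15 A) ⟨
    (K * M) ^ (5 * B) * N ^ (15 * A)   ∎
    where
    open ≤-Reasoning
    open +-*-Solver
    z = N ^ A
    ^-*-comm : ∀ x c e → x ^ (c * e) ≡ (x ^ e) ^ c
    ^-*-comm x c e = trans (cong (x ^_) (*-comm c e)) (sym (^-*-assoc x e c))
    instance
      K*M≢0 : NonZero (K * M)
      K*M≢0 = m*n≢0 K M {{m^n≢0 M P₀}}

  N^B<[1+N]^[5B]*N^[5A] : ∀ N .{{_ : NonZero N}} → N ^ B < suc N ^ (5 * B) * N ^ (5 * A)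
  N^B<[1+N]^[5B]*N^[5A] N = begin-strict
    N ^ B                           <⟨ ^-monoˡ-< B (n<1+n N) ⟩
    suc N ^ B                       ≤⟨ ^-monoʳ-≤ (suc N) (m≤n*m B 5) ⟩
    suc N ^ (5 * B)                 ≤⟨ m≤m*n (suc N ^ (5 * B)) (N ^ (5 * A)) {{m^n≢0 N (5 * A)}} ⟩
    suc N ^ (5 * B) * N ^ (5 * A)   ∎
    where open ≤-Reasoning

module Estimate (a b : ℕ) where

  open import Data.Nat as ℕ using (suc; NonZero)
  import Data.Nat.Properties as ℕ
  open import Data.Nat.GCD using (gcd)
  open import Data.Rational using (0ℚ; _+_; _*_; _≤_)
  open import Data.Rational.Properties
  open Arithmetic using (least; dyadic-bracket; τ)
  open Sums
  open Growth a b
    using (A; B; M; P₀; K; M≢0; τ^B≤K*q^A; [1+k]^B≤M*N^A; exponent-bound; N^B<[1+N]^[5B]*N^[5A])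

  n c : ℕ
  n = 5 ℕ.* B
  c = K ℕ.* M

  instance
    c≢0 : NonZero c
    c≢0 = ℕ.m*n≢0 K M {{ℕ.m^n≢0 M P₀}}

  -- Large N g: g > N^(1/5 - A/B), raised to the power 5B as in the definition of S.
  Large : ℕ → ℕ → Set
  Large N g = N ℕ.^ B ℕ.< g ℕ.^ n ℕ.* N ℕ.^ (5 ℕ.* A)

  large? : ∀ N → Decidable (Large N)
  large? N g = N ℕ.^ B ℕ.<? g ℕ.^ n ℕ.* N ℕ.^ (5 ℕ.* A)

  S-as-∑ : ∀ q → S A B (suc q) ≡ ∑[ r < suc q ] (𝟙 (large? (suc q) (gcd r (suc q))) * recip r)
  S-as-∑ q = trans (sumℚ-filter (λ r → large? N (gcd r N)) recip suc q)
                   (sym (trans (cong (_+ rest) (*-zeroʳ (𝟙 (large? N (gcd 0 N))))) (+-identityˡ rest)))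
    where
    N = suc q
    rest = ∑[ i < q ] (𝟙 (large? N (gcd (suc i) N)) * recip (suc i))

  S-nonNeg : ∀ q → 0ℚ ≤ S A B (suc q)
  S-nonNeg q = subst (0ℚ ≤_) (sym (S-as-∑ q))
    (∑-nonNeg (suc q) (λ r _ → *-nonNeg (𝟙-nonNeg (large? (suc q) (gcd r (suc q)))) (recip-nonNeg r)))

  S-≤ : ∀ q g₀ k .{{_ : NonZero g₀}} → (∀ {g} → Large (suc q) g → g₀ ℕ.≤ g) → suc q ℕ.< 2 ℕ.^ suc k →
        S A B (suc q) ≤ fromℕ (τ (suc q) ℕ.* suc k) * recip g₀
  S-≤ q g₀ k Large⇒g₀≤ N<2^[1+k] = begin
    S A B N                                         ≡⟨ S-as-∑ q ⟩
    ∑[ r < N ] (𝟙 (large? N (gcd r N)) * recip r)   ≤⟨ ∑-recip-gcd-≤ N g₀ (large? N) Large⇒g₀≤ ⟩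
    fromℕ (τ N) * (H (suc N) * recip g₀)            ≤⟨ *-monoˡ-≤-0≤ (fromℕ-nonNeg (τ N)) (*-monoʳ-≤-0≤ (recip-nonNeg g₀) H≤) ⟩
    fromℕ (τ N) * (fromℕ (suc k) * recip g₀)        ≡⟨ *-assoc (fromℕ (τ N)) (fromℕ (suc k)) (recip g₀) ⟨
    fromℕ (τ N) * fromℕ (suc k) * recip g₀          ≡⟨ cong (_* recip g₀) (fromℕ-homo-* (τ N) (suc k)) ⟨
    fromℕ (τ N ℕ.* suc k) * recip g₀                ∎
    where
    open ≤-Reasoning
    N = suc q
    H≤ : H (suc N) ≤ fromℕ (suc k)
    H≤ = ≤-trans (H-mono-≤ N<2^[1+k]) (H-2^-≤ (suc k))

  S^n-bound : ∀ q → S A B (suc q) ^ℚ n * fromℕ (suc q ℕ.^ B) ≤ fromℕ c ^ℚ n * fromℕ (suc q ℕ.^ (15 ℕ.* A))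
  S^n-bound q with least (large? (suc q)) {suc (suc q)} (N^B<[1+N]^[5B]*N^[5A] (suc q)) | dyadic-bracket (suc q)
  ... | ℕ.zero , N^B<0 , _ | _ = contradiction N^B<0 ℕ.n≮0
  ... | g₀@(suc _) , N^B<g₀^n*N^5A , below | k , 2^k≤N , N<2^[1+k] = begin
    S A B N ^ℚ n * fromℕ (N ℕ.^ B)                       ≤⟨ ^ℚ*fromℕ-≤ (τ N ℕ.* suc k) g₀ n (S-nonNeg q)
                                                               (S-≤ q g₀ k g₀-least N<2^[1+k]) (ℕ.<⇒≤ N^B<g₀^n*N^5A) ⟩
    fromℕ ((τ N ℕ.* suc k) ℕ.^ n ℕ.* N ℕ.^ (5 ℕ.* A))   ≤⟨ fromℕ-mono-≤ (exponent-bound {τ N} {suc k} {N}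
                                                               (τ^B≤K*q^A N) ([1+k]^B≤M*N^A 2^k≤N)) ⟩
    fromℕ (c ℕ.^ n ℕ.* N ℕ.^ (15 ℕ.* A))                ≡⟨ fromℕ-homo-* (c ℕ.^ n) (N ℕ.^ (15 ℕ.* A)) ⟩
    fromℕ (c ℕ.^ n) * fromℕ (N ℕ.^ (15 ℕ.* A))          ≡⟨ cong (_* fromℕ (N ℕ.^ (15 ℕ.* A))) (fromℕ-homo-^ c n) ⟩
    fromℕ c ^ℚ n * fromℕ (N ℕ.^ (15 ℕ.* A))             ∎
    where
    open ≤-Reasoning
    N = suc q
    g₀-least : ∀ {g} → Large N g → g₀ ℕ.≤ g
    g₀-least large = ℕ.≮⇒≥ (λ g<g₀ → below g<g₀ large)

open import Data.Nat using (ℕ; suc; _*_; _^_)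
open import Data.Integer using (+_)
open import Data.Product using (∃-syntax; _×_)
open import Data.Rational using (ℚ; 0ℚ; _<_; _≤_; _/_) renaming (_*_ to _*ℚ_)
open import Data.Rational.Properties using (positive⁻¹; normalize-pos)
open Sums using (fromℕ)

lemma7 : (a b : ℕ) → ∃[ C ] (0ℚ < C × ((q : ℕ) →
    (S (suc a) (suc b) (suc q) ^ℚ (5 * suc b)) *ℚ ((+ (suc q ^ suc b)) / 1)
    ≤ (C ^ℚ (5 * suc b)) *ℚ ((+ (suc q ^ (15 * suc a))) / 1)))
lemma7 a b = fromℕ c , positive⁻¹ (fromℕ c) {{normalize-pos c 1}} , S^n-bound
  where open Estimate a b
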